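{- Let $\mathsf{R}^s$ be the set of all symmetric Epstein relations and $\mathsf{R}^n$ the set of all Epstein relations $\mathfrak{R}$ such that for all $\varphi,\psi\in\mathsf{FOR}$, $\langle\neg\varphi,\psi\rangle\in\mathfrak{R}$ implies $\langle\varphi,\psi\rangle\in\mathfrak{R}$. Neither $\mathsf{R}^s$ nor $\mathsf{R}^n$ is definable.
   Context: Let $\Phi=\{p_0,p_1,\dots\}$ be a countably infinite set of propositional letters; $\mathsf{FOR}$ is the set of formulas built from $\Phi$ with $\neg$ and binary $\lor,\wedge,\to,\leftrightarrow,\vartriangle,\looparrowright$. An Epstein relation is any $\mathfrak{R}\subseteq\mathsf{FOR}^2$; an Epstein model is $\langle v,\mathfrak{R}\rangle$ with $v:\Phi\to\{0,1\}$. Truth: $\langle v,\mathfrak{R}\rangle\vDash p$ iff $v(p)=1$; classical clauses for $\neg,\wedge,\lor,\to,\leftrightarrow$; $\vDash\psi\vartriangle\chi$ iff both $\psi,\chi$ true and $\langle\psi,\chi\rangle\in\mathfrak{R}$; $\vDash\psi\looparrowright\chi$ iff ($\psi$ false or $\chi$ true) and $\langle\psi,\chi\rangle\in\mathfrak{R}$. $\mathfrak{R}\vDash\Gamma$ iff $\langle v,\mathfrak{R}\rangle\vDash\gamma$ for every valuation $v$ and every $\gamma\in\Gamma$. A set $\mathsf{K}$ of Epstein relations is definable iff there is $\Gamma\subseteq\mathsf{FOR}$ such that for every Epstein relation $\mathfrak{R}$: $\mathfrak{R}\vDash\Gamma$ iff $\mathfrak{R}\in\mathsf{K}$. -}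

module Defs where

open import Data.Nat using (ℕ)
open import Data.Bool using (Bool; true; false; not; _∧_; _∨_; if_then_else_)
open import Data.Product using (Σ; _×_)
open import Relation.Binary.PropositionalEquality using (_≡_)

infixr 5 _⊃_
data FOR : Set where
  var   : ℕ → FOR
  ¬'_   : FOR → FOR
  _∨'_  : FOR → FOR → FOR
  _∧'_  : FOR → FOR → FOR
  _⊃_   : FOR → FOR → FOR
  _⇔'_  : FOR → FOR → FOR
  _△_   : FOR → FOR → FOR
  _↬_   : FOR → FOR → FOR

EpsteinRelation : Set
EpsteinRelation = FOR → FOR → Bool

Valuation : Set
Valuation = ℕ → Bool

_⇒ᵇ_ : Bool → Bool → Bool
a ⇒ᵇ b = not a ∨ b

_⇔ᵇ_ : Bool → Bool → Bool
a ⇔ᵇ b = (a ⇒ᵇ b) ∧ (b ⇒ᵇ a)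

⟦_⟧ : FOR → Valuation → EpsteinRelation → Bool
⟦ var p ⟧   v R = v p
⟦ ¬' φ ⟧    v R = not (⟦ φ ⟧ v R)
⟦ φ ∨' ψ ⟧  v R = ⟦ φ ⟧ v R ∨ ⟦ ψ ⟧ v R
⟦ φ ∧' ψ ⟧  v R = ⟦ φ ⟧ v R ∧ ⟦ ψ ⟧ v R
⟦ φ ⊃ ψ ⟧   v R = ⟦ φ ⟧ v R ⇒ᵇ ⟦ ψ ⟧ v R
⟦ φ ⇔' ψ ⟧  v R = ⟦ φ ⟧ v R ⇔ᵇ ⟦ ψ ⟧ v R
⟦ φ △ ψ ⟧   v R = (⟦ φ ⟧ v R ∧ ⟦ ψ ⟧ v R) ∧ R φ ψ
⟦ φ ↬ ψ ⟧   v R = (⟦ φ ⟧ v R ⇒ᵇ ⟦ ψ ⟧ v R) ∧ R φ ψ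

_,_⊨_ : Valuation → EpsteinRelation → FOR → Set
v , R ⊨ φ = ⟦ φ ⟧ v R ≡ true

_⊨Γ_ : EpsteinRelation → (FOR → Set) → Set
R ⊨Γ Γ = ∀ (v : Valuation) (γ : FOR) → Γ γ → v , R ⊨ γ

Definable : (EpsteinRelation → Set) → Set₁
Definable K = Σ (FOR → Set) λ Γ → ∀ (R : EpsteinRelation) →
  ((R ⊨Γ Γ → K R) × (K R → R ⊨Γ Γ))

Rˢ : EpsteinRelation → Set
Rˢ R = ∀ (φ ψ : FOR) → R φ ψ ≡ true → R ψ φ ≡ true

Rⁿ : EpsteinRelation → Set
Rⁿ R = ∀ (φ ψ : FOR) → R (¬' φ) ψ ≡ true → R φ ψ ≡ true

-- The validity of a formula in R cannot depend on the value of R at a pair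
-- ⟨φ, ψ⟩ with φ valid and ψ unsatisfiable: there φ ▵ ψ and φ ↬ ψ are false
-- whatever R says. So the total relation validates the same formulas as the
-- total relation with such pairs removed, e.g. ⟨⊤₀, ¬⊤₀⟩ for ⊤₀ = p₀ ∨ ¬p₀.
-- The first is symmetric and in 𝖱ⁿ; the second is neither, since it keeps
-- ⟨¬⊤₀, ⊤₀⟩ and ⟨¬⊤₀, ¬⊤₀⟩.
module Submission where

open import Defs
open import Data.Bool using (Bool; true; false; not; _∧_; _∨_)
open import Data.Bool.Properties using (∧-conicalˡ; ∧-conicalʳ; not-injective)
open import Data.Nat using (zero; suc)
open import Data.Product using (_×_; _,_; proj₁; proj₂)
open import Data.Sum using (_⊎_; inj₁; inj₂)
open import Relation.Binary.PropositionalEquality using (_≡_; refl; cong; cong₂; sym; trans)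
open import Relation.Nullary using (¬_)

Valid : EpsteinRelation → FOR → Set
Valid R φ = ∀ v → v , R ⊨ φ

¬Definable-of-same-theory : ∀ (K : EpsteinRelation → Set) {R R′ : EpsteinRelation} →
  (∀ χ v → ⟦ χ ⟧ v R ≡ ⟦ χ ⟧ v R′) → K R → ¬ K R′ → ¬ Definable K
¬Definable-of-same-theory K same k ¬k′ (Γ , defines) =
  ¬k′ (proj₁ (defines _) λ v γ γ∈Γ → trans (sym (same γ v)) (proj₂ (defines _) k v γ γ∈Γ))

-- Both Epstein connectives are of the form (f ⟦φ⟧ ⟦ψ⟧) ∧ R φ ψ with f true false = false.
epstein-agree : ∀ (f : Bool → Bool → Bool) {x x′ y y′ r r′ : Bool} → f true false ≡ false →
  x ≡ x′ → y ≡ y′ → r ≡ r′ ⊎ (x ≡ true × y ≡ false) → f x y ∧ r ≡ f x′ y′ ∧ r′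
epstein-agree f f10 refl refl (inj₁ refl)          = refl
epstein-agree f f10 refl refl (inj₂ (refl , refl)) rewrite f10 = refl

⟦⟧-agree : ∀ {R R′ : EpsteinRelation} →
  (∀ φ ψ → R φ ψ ≡ R′ φ ψ ⊎ (Valid R φ × Valid R (¬' ψ))) →
  ∀ χ v → ⟦ χ ⟧ v R ≡ ⟦ χ ⟧ v R′
⟦⟧-agree {R} {R′} agree = go
  where
  at : ∀ φ ψ v → R φ ψ ≡ R′ φ ψ ⊎ (⟦ φ ⟧ v R ≡ true × ⟦ ψ ⟧ v R ≡ false)
  at φ ψ v with agree φ ψ
  ... | inj₁ same            = inj₁ same
  ... | inj₂ (valid , unsat) = inj₂ (valid v , not-injective (unsat v))

  go : ∀ χ v → ⟦ χ ⟧ v R ≡ ⟦ χ ⟧ v R′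
  go (var p)  v = refl
  go (¬' φ)   v = cong not (go φ v)
  go (φ ∨' ψ) v = cong₂ _∨_ (go φ v) (go ψ v)
  go (φ ∧' ψ) v = cong₂ _∧_ (go φ v) (go ψ v)
  go (φ ⊃ ψ)  v = cong₂ _⇒ᵇ_ (go φ v) (go ψ v)
  go (φ ⇔' ψ) v = cong₂ _⇔ᵇ_ (go φ v) (go ψ v)
  go (φ △ ψ)  v = epstein-agree _∧_ refl (go φ v) (go ψ v) (at φ ψ v)
  go (φ ↬ ψ)  v = epstein-agree _⇒ᵇ_ refl (go φ v) (go ψ v) (at φ ψ v)

onlyP₀ : FOR → Bool
onlyP₀ (var zero)    = true
onlyP₀ (var (suc _)) = false
onlyP₀ (¬' φ)        = onlyP₀ φ
onlyP₀ (φ ∨' ψ)      = onlyP₀ φ ∧ onlyP₀ ψ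
onlyP₀ (φ ∧' ψ)      = onlyP₀ φ ∧ onlyP₀ ψ
onlyP₀ (φ ⊃ ψ)       = onlyP₀ φ ∧ onlyP₀ ψ
onlyP₀ (φ ⇔' ψ)      = onlyP₀ φ ∧ onlyP₀ ψ
onlyP₀ (φ △ ψ)       = onlyP₀ φ ∧ onlyP₀ ψ
onlyP₀ (φ ↬ ψ)       = onlyP₀ φ ∧ onlyP₀ ψ

constant : Bool → Valuation
constant b _ = b

⟦⟧-onlyP₀ : ∀ φ v R → onlyP₀ φ ≡ true → ⟦ φ ⟧ v R ≡ ⟦ φ ⟧ (constant (v zero)) R
⟦⟧-onlyP₀ φ v R = go φ
  where
  go : ∀ φ → onlyP₀ φ ≡ true → ⟦ φ ⟧ v R ≡ ⟦ φ ⟧ (constant (v zero)) R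
  both : ∀ f φ ψ → onlyP₀ φ ∧ onlyP₀ ψ ≡ true →
    f (⟦ φ ⟧ v R) (⟦ ψ ⟧ v R) ≡ f (⟦ φ ⟧ (constant (v zero)) R) (⟦ ψ ⟧ (constant (v zero)) R)

  both f φ ψ h = cong₂ f (go φ (∧-conicalˡ _ _ h)) (go ψ (∧-conicalʳ _ _ h))

  go (var zero) h = refl
  go (¬' φ)     h = cong not (go φ h)
  go (φ ∨' ψ)   h = both _∨_ φ ψ h
  go (φ ∧' ψ)   h = both _∧_ φ ψ h
  go (φ ⊃ ψ)    h = both _⇒ᵇ_ φ ψ h
  go (φ ⇔' ψ)   h = both _⇔ᵇ_ φ ψ h
  go (φ △ ψ)    h = cong (_∧ R φ ψ) (both _∧_ φ ψ h)
  go (φ ↬ ψ)    h = cong (_∧ R φ ψ) (both _⇒ᵇ_ φ ψ h)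

validP₀ : EpsteinRelation → FOR → Bool
validP₀ R φ = onlyP₀ φ ∧ (⟦ φ ⟧ (constant true) R ∧ ⟦ φ ⟧ (constant false) R)

validP₀-sound : ∀ R φ → validP₀ R φ ≡ true → Valid R φ
validP₀-sound R φ h v = trans (⟦⟧-onlyP₀ φ v R (∧-conicalˡ (onlyP₀ φ) _ h)) (at (v zero))
  where
  atBoth : ⟦ φ ⟧ (constant true) R ∧ ⟦ φ ⟧ (constant false) R ≡ true
  atBoth = ∧-conicalʳ (onlyP₀ φ) _ h

  at : ∀ b → ⟦ φ ⟧ (constant b) R ≡ true
  at true  = ∧-conicalˡ _ (⟦ φ ⟧ (constant false) R) atBoth
  at false = ∧-conicalʳ (⟦ φ ⟧ (constant true) R) _ atBoth

total : EpsteinRelation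
total _ _ = true

total∖valid×unsat : EpsteinRelation
total∖valid×unsat φ ψ = not (validP₀ total φ ∧ validP₀ total (¬' ψ))

total-agrees : ∀ φ ψ →
  total φ ψ ≡ total∖valid×unsat φ ψ ⊎ (Valid total φ × Valid total (¬' ψ))
total-agrees φ ψ with validP₀ total φ in valid | validP₀ total (¬' ψ) in unsat
... | true  | true  = inj₂ (validP₀-sound total φ valid , validP₀-sound total (¬' ψ) unsat)
... | true  | false = inj₁ refl
... | false | _     = inj₁ refl

⊤₀ : FOR
⊤₀ = var zero ∨' (¬' var zero)

mainTheorem13 : (¬ Definable Rˢ) × (¬ Definable Rⁿ)
mainTheorem13 =
    ¬Definable-of-same-theory Rˢ same (λ _ _ _ → refl) (λ symmetric → false≢true (symmetric (¬' ⊤₀) ⊤₀ refl))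
  , ¬Definable-of-same-theory Rⁿ same (λ _ _ _ → refl) (λ closed → false≢true (closed ⊤₀ (¬' ⊤₀) refl))
  where
  same : ∀ χ v → ⟦ χ ⟧ v total ≡ ⟦ χ ⟧ v total∖valid×unsat
  same = ⟦⟧-agree total-agrees

  false≢true : ¬ (false ≡ true)
  false≢true ()
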